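{- Let $p$ be an odd prime and $k\ge1$. Let $N(p^k)$ be the subgraph of $\Gamma(p^k)$ induced on the multiples of $p$ in $\{0,\dots,p^k-1\}$. Then $N(p^k)$ is a tree rooted at $0$ (with a loop at $0$, all edges directed towards $0$) with $p^{k-1}$ vertices. The vertices other than $0$ having an edge into $0$ are exactly the numbers $y p^\ell$ with $k/2\le \ell<k$, $1\le y\le p^{k-\ell}$, $\gcd(y,p)=1$, and for each such vertex, its in-tree is isomorphic to $\mathcal T_p(\hat y,\ell)$, where $\hat y=y\bmod p$. More generally, for every $x\in\{1,\dots,p^k-1\}$ with $p\mid x$, writing uniquely $x=\tilde x p^\ell$ with $\gcd(\tilde x,p)=1$, the in-tree of $x$ is isomorphic (as a rooted tree) to $\mathcal T_p(\hat x,\ell)$, where $\hat x=\tilde x\bmod p$.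
   Context: $\Gamma(n)$ is the directed graph on $\{0,\dots,n-1\}$ with an edge $x\to (x^2\bmod n)$ for each $x$. For a vertex $x\ne 0$ of $N(p^k)$, its in-tree is the subgraph induced on $x$ together with all vertices having a directed path to $x$, regarded as a rooted tree with root $x$ and edges directed towards the root. For $\hat x\in\{1,\dots,p-1\}$ and integer $\ell\ge1$, the rooted tree $\mathcal T_p(\hat x,\ell)$ (edges directed towards the root) is defined recursively: (1) if $\ell$ is odd, it is a single vertex with no edges; (2) if $\ell$ is even and $\hat x$ is not a square modulo $p$, it is a single vertex with no edges; (3) if $\ell$ is even and $\hat x$ has two square roots $z_1,z_2\in\{1,\dots,p-1\}$ modulo $p$, it consists of a root into which $2p^{\ell/2}$ subtrees map (each subtree's root having an edge to the root): $p^{\ell/2}$ copies of $\mathcal T_p(z_1,\ell/2)$ and $p^{\ell/2}$ copies of $\mathcal T_p(z_2,\ell/2)$. -}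

module Defs where

open import Data.Nat using (ℕ; zero; suc; _+_; _*_; _∸_; _^_; _<_; _≟_; ⌊_/2⌋)
open import Data.Nat.DivMod using (_%_)
open import Data.Nat.Divisibility using (_∣_)
open import Data.Bool using (Bool; if_then_else_)
open import Data.List using (List; []; _∷_; length; lookup; filter; map; upTo; concatMap; replicate)
open import Data.Fin using (Fin)
open import Data.Product using (_×_; Σ; ∃)
open import Relation.Nullary using (does)
open import Relation.Binary.PropositionalEquality using (_≡_)
open import Relation.Binary.Construct.Closure.ReflexiveTransitive using (Star)

-- Arithmetic: x mod n (with the convention x mod 0 = x; only n ≥ 1 is used)

_mod_ : ℕ → ℕ → ℕ
x mod zero    = x
x mod (suc n) = x % suc n

ΓVert : ℕ → ℕ → Set
ΓVert n x = x < n

ΓEdge : ℕ → ℕ → ℕ → Set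
ΓEdge n x y = ΓVert n x × y ≡ (x * x) mod n

NVert : (p k : ℕ) → ℕ → Set
NVert p k x = x < p ^ k × p ∣ x

NEdge : (p k : ℕ) → ℕ → ℕ → Set
NEdge p k x y = NVert p k x × NVert p k y × ΓEdge (p ^ k) x y

NPath : (p k : ℕ) → ℕ → ℕ → Set
NPath p k = Star (NEdge p k)

InTree : (p k : ℕ) → (x y : ℕ) → Set
InTree p k x y = NVert p k y × NPath p k y x

-- Abstract rooted (unordered) trees, edges directed towards the root

data RTree : Set where
  node : List RTree → RTree

data Pos : RTree → Set where
  root  : ∀ {t} → Pos t
  child : ∀ {ts} (i : Fin (length ts)) → Pos (lookup ts i) → Pos (node ts)

data TEdge : {t : RTree} → Pos t → Pos t → Set where
  top  : ∀ {ts} {i : Fin (length ts)} → TEdge {node ts} (child i root) root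
  down : ∀ {ts} {i : Fin (length ts)} {a b : Pos (lookup ts i)} →
         TEdge a b → TEdge {node ts} (child i a) (child i b)

record InTreeIso (p k x : ℕ) (t : RTree) : Set where
  field
    φ      : Pos t → ℕ
    φ-root : φ root ≡ x
    φ-inj  : ∀ a b → φ a ≡ φ b → a ≡ b
    φ-into : ∀ a → InTree p k x (φ a)
    φ-onto : ∀ y → InTree p k x y → ∃ λ a → φ a ≡ y
    φ-hom  : ∀ a b → TEdge a b → NEdge p k (φ a) (φ b)
    φ-refl : ∀ a b → NEdge p k (φ a) (φ b) → TEdge a b

sqrts : (p x : ℕ) → List ℕ
sqrts p x = filter (λ z → ((z * z) mod p) ≟ (x mod p)) (map suc (upTo (p ∸ 1)))

isEven : ℕ → Bool
isEven ℓ = does ((ℓ mod 2) ≟ 0)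

-- fuel-driven version of the recursion (the fuel ℓ is always enough, since
-- ℓ/2 < ℓ for ℓ ≥ 1)
𝒯-fuel : (p : ℕ) → (fuel x ℓ : ℕ) → RTree
𝒯-fuel p zero     x ℓ = node []
𝒯-fuel p (suc f) x ℓ =
  if isEven ℓ
  then node (concatMap (λ z → replicate (p ^ ⌊ ℓ /2⌋) (𝒯-fuel p f z ⌊ ℓ /2⌋)) (sqrts p x))
  else node []

𝒯 : (p x ℓ : ℕ) → RTree
𝒯 p x ℓ = 𝒯-fuel p ℓ x ℓ

{-# OPTIONS --safe #-}
module Submission where

-- Write a vertex as x = x̃ p^ℓ with p ∤ x̃. Squaring doubles ℓ, so every vertex reaches 0, no other
-- vertex lies on a cycle, and x → 0 exactly when 2ℓ ≥ k. For 0 < ℓ < k, comparing p-adic valuations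
-- shows that y² ≡ x (mod p^k) forces ℓ = 2m, y = w p^m and w² ≡ x̃ (mod P) with P = p^(k-ℓ). As p is odd,
-- Hensel's lemma lifts each square root z of x̃ mod p to a unique root h_z < P, so the preimages of x are
-- the numbers (h_z + j P) p^m with j < p^m: p^m of them for each z, each with unit part ≡ z (mod p).
-- Induction on ℓ then identifies the in-tree of x with 𝒯_p(x̂, ℓ).

module Congruence where
  open import Data.Nat as ℕ using (ℕ; suc; _<_; NonZero)
  import Data.Nat.Divisibility as ℕ
  open import Data.Nat.DivMod using (_%_; _/_; m≡m%n+[m/n]*n; [m+kn]%n≡m%n; m<n⇒m%n≡m)
  open import Data.Integer using (+_; -[1+_]; _+_; _-_; _*_; -_)
  open import Data.Integer.Properties
    using (pos-+; pos-*; +-injective; +-inverseʳ; +-identityʳ; *-assoc; *-cancelʳ-≡; +-minus-telescope)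
  open import Data.Integer.Divisibility.Signed
  open import Data.Integer.Tactic.RingSolver using (solve-∀)
  open import Relation.Binary.PropositionalEquality

  infix 4 _≡_[mod_]

  record _≡_[mod_] (a b N : ℕ) : Set where
    constructor mod-intro
    field ∣-difference : + N ∣ + a - + b

  private
    [x+y]-x≡y : ∀ x y → (x + y) - x ≡ y
    [x+y]-x≡y = solve-∀

    x*z-y*z≡[x-y]*z : ∀ x y z → x * z - y * z ≡ (x - y) * z
    x*z-y*z≡[x-y]*z = solve-∀

  pos-+-* : ∀ a q N → + (a ℕ.+ q ℕ.* N) ≡ + a + + q * + N
  pos-+-* a q N = trans (pos-+ a (q ℕ.* N)) (cong (_+_ (+ a)) (pos-* q N))

  ∣-cong : ∀ {N x y} → x ≡ y → N ∣ x → N ∣ y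
  ∣-cong refl d = d

  ∣⇒mod0 : ∀ {N a} → N ℕ.∣ a → a ≡ 0 [mod N ]
  ∣⇒mod0 {a = a} d = mod-intro (∣-cong (sym (+-identityʳ (+ a))) (∣ᵤ⇒∣ d))

  mod0⇒∣ : ∀ {N a} → a ≡ 0 [mod N ] → N ℕ.∣ a
  mod0⇒∣ {a = a} (mod-intro d) = ∣⇒∣ᵤ (∣-cong (+-identityʳ (+ a)) d)

  mod-refl : ∀ {N} a → a ≡ a [mod N ]
  mod-refl a = mod-intro (∣-cong (sym (+-inverseʳ (+ a))) (divides (+ 0) refl))

  mod-sym : ∀ {N a b} → a ≡ b [mod N ] → b ≡ a [mod N ]
  mod-sym {N} {a} {b} (mod-intro d) = mod-intro (∣-cong (neg-diff (+ a) (+ b)) (∣m⇒∣-m d))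
    where
    neg-diff : ∀ x y → - (x - y) ≡ y - x
    neg-diff = solve-∀

  mod-trans : ∀ {N a b c} → a ≡ b [mod N ] → b ≡ c [mod N ] → a ≡ c [mod N ]
  mod-trans {N} {a} {b} {c} (mod-intro d) (mod-intro e) =
    mod-intro (∣-cong (+-minus-telescope (+ a) (+ b) (+ c)) (∣m∣n⇒∣m+n d e))

  mod-weaken : ∀ {M N a b} → M ℕ.∣ N → a ≡ b [mod N ] → a ≡ b [mod M ]
  mod-weaken M∣N (mod-intro d) = mod-intro (∣-trans (∣ᵤ⇒∣ M∣N) d)

  mod-∣ : ∀ {M N a b} → M ℕ.∣ N → a ≡ b [mod N ] → M ℕ.∣ a → M ℕ.∣ b
  mod-∣ M∣N a≡b M∣a = mod0⇒∣ (mod-trans (mod-sym (mod-weaken M∣N a≡b)) (∣⇒mod0 M∣a))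

  mod-+-multiple : ∀ N a j → a ℕ.+ j ℕ.* N ≡ a [mod N ]
  mod-+-multiple N a j =
    mod-intro (divides (+ j) (trans (cong (_- + a) (pos-+-* a j N)) ([x+y]-x≡y (+ a) (+ j * + N))))

  mod-square : ∀ {N a b} → a ≡ b [mod N ] → a ℕ.* a ≡ b ℕ.* b [mod N ]
  mod-square {N} {a} {b} (mod-intro d) = mod-intro
    (∣-cong (trans (factor (+ a) (+ b)) (sym (cong₂ _-_ (pos-* a a) (pos-* b b)))) (∣m⇒∣m*n (+ a + + b) d))
    where
    factor : ∀ x y → (x - y) * (x + y) ≡ x * x - y * y
    factor = solve-∀

  mod-*-scale : ∀ {N a b} c → a ≡ b [mod N ] → a ℕ.* c ≡ b ℕ.* c [mod N ℕ.* c ]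
  mod-*-scale {N} {a} {b} c (mod-intro (divides q eq)) = mod-intro (divides q (begin
    + (a ℕ.* c) - + (b ℕ.* c)  ≡⟨ cong₂ _-_ (pos-* a c) (pos-* b c) ⟩
    + a * + c - + b * + c      ≡⟨ x*z-y*z≡[x-y]*z (+ a) (+ b) (+ c) ⟩
    (+ a - + b) * + c          ≡⟨ cong (_* + c) eq ⟩
    q * + N * + c              ≡⟨ *-assoc q (+ N) (+ c) ⟩
    q * (+ N * + c)            ≡⟨ cong (q *_) (pos-* N c) ⟨
    q * + (N ℕ.* c)            ∎))
    where open ≡-Reasoning

  mod-*-cancel : ∀ {N a b} c .{{_ : NonZero c}} → a ℕ.* c ≡ b ℕ.* c [mod N ℕ.* c ] → a ≡ b [mod N ]
  mod-*-cancel {N} {a} {b} c (mod-intro (divides q eq)) = mod-intro (divides q (*-cancelʳ-≡ _ _ (+ c) (begin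
    (+ a - + b) * + c          ≡⟨ x*z-y*z≡[x-y]*z (+ a) (+ b) (+ c) ⟨
    + a * + c - + b * + c      ≡⟨ cong₂ _-_ (pos-* a c) (pos-* b c) ⟨
    + (a ℕ.* c) - + (b ℕ.* c)  ≡⟨ eq ⟩
    q * + (N ℕ.* c)            ≡⟨ cong (q *_) (pos-* N c) ⟩
    q * (+ N * + c)            ≡⟨ *-assoc q (+ N) (+ c) ⟨
    q * + N * + c              ∎)))
    where open ≡-Reasoning

  mod-% : ∀ a N .{{_ : NonZero N}} → a ≡ a % N [mod N ]
  mod-% a N = mod-intro (divides (+ (a / N)) (begin
    + a - + (a % N)                           ≡⟨ cong (λ z → + z - + (a % N)) (m≡m%n+[m/n]*n a N) ⟩
    + (a % N ℕ.+ a / N ℕ.* N) - + (a % N)     ≡⟨ cong (_- + (a % N)) (pos-+-* (a % N) (a / N) N) ⟩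
    (+ (a % N) + + (a / N) * + N) - + (a % N) ≡⟨ [x+y]-x≡y (+ (a % N)) (+ (a / N) * + N) ⟩
    + (a / N) * + N                           ∎))
    where open ≡-Reasoning

  %⇒mod : ∀ {N a b} .{{_ : NonZero N}} → a % N ≡ b % N → a ≡ b [mod N ]
  %⇒mod {N} {a} {b} eq =
    mod-trans (mod-% a N) (subst (λ r → r ≡ b [mod N ]) (sym eq) (mod-sym (mod-% b N)))

  -- Over ℤ the congruence reads a ≡ b + Q N; the sign of Q decides which side carries the multiple.
  mod⇒% : ∀ {N a b} .{{_ : NonZero N}} → a ≡ b [mod N ] → a % N ≡ b % N
  mod⇒% {N} {a} {b} (mod-intro (divides (+ q) eq)) =
    trans (cong (_% N) (+-injective (trans (shift (+ a) (+ b) (+ q) (+ N) eq) (sym (pos-+-* b q N)))))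
          ([m+kn]%n≡m%n b q N)
    where
    shift : ∀ x y s n → x - y ≡ s * n → x ≡ y + s * n
    shift x y s n e = trans (restore x y) (cong (_+_ y) e)
      where
      restore : ∀ x y → x ≡ y + (x - y)
      restore = solve-∀
  mod⇒% {N} {a} {b} (mod-intro (divides -[1+ q ] eq)) =
    sym (trans (cong (_% N) (+-injective (trans (shift (+ a) (+ b) (+ suc q) (+ N) eq) (sym (pos-+-* a (suc q) N)))))
               ([m+kn]%n≡m%n a (suc q) N))
    where
    shift : ∀ x y s n → x - y ≡ (- s) * n → y ≡ x + s * n
    shift x y s n e = trans (restore x y) (trans (cong (_-_ x) e) (negate x s n))
      where
      restore : ∀ x y → y ≡ x - (x - y)
      restore = solve-∀
      negate : ∀ x s n → x - (- s) * n ≡ x + s * n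
      negate = solve-∀

  mod⇒%≡ : ∀ {N a b} .{{_ : NonZero N}} → b < N → a ≡ b [mod N ] → a % N ≡ b
  mod⇒%≡ b<N d = trans (mod⇒% d) (m<n⇒m%n≡m b<N)

open Congruence

open import Data.Nat using (ℕ)
open import Data.Nat.Primality using (Prime)
open import Data.Nat.Divisibility using (_∣_)
open import Relation.Nullary using (¬_)

module PrimeProperties {p : ℕ} (pr : Prime p) where
  open import Data.Nat
  open import Data.Nat.Properties
  open import Data.Nat.Divisibility
  open import Data.Nat.Primality using (euclidsLemma; prime⇒nonZero; prime⇒irreducible; prime⇒nonTrivial)
  open import Data.Nat.Coprimality using (Coprime)
  open import Data.Nat.Induction using (<-rec)
  open import Data.Sum using (inj₁; inj₂)
  open import Data.Product using (_×_; _,_; ∃₂)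
  open import Relation.Binary.Definitions using (tri<; tri≈; tri>)
  open import Relation.Nullary using (yes; no)
  open import Data.Empty using (⊥-elim)
  open import Relation.Binary.PropositionalEquality

  instance
    p≢0 : NonZero p
    p≢0 = prime⇒nonZero pr

  2≤p : 2 ≤ p
  2≤p = nonTrivial⇒n>1 p {{prime⇒nonTrivial pr}}

  p∤1 : ¬ p ∣ 1
  p∤1 p∣1 = <⇒≱ 2≤p (∣⇒≤ p∣1)

  ∤⇒coprime : ∀ {w} → ¬ p ∣ w → Coprime w p
  ∤⇒coprime p∤w (d∣w , d∣p) with prime⇒irreducible pr d∣p
  ... | inj₁ d≡1 = d≡1
  ... | inj₂ refl = ⊥-elim (p∤w d∣w)

  coprime⇒∤ : ∀ {w} → Coprime w p → ¬ p ∣ w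
  coprime⇒∤ c p∣w = p∤1 (subst (p ∣_) (c (p∣w , ∣-refl)) ∣-refl)

  ∤⇒≥1 : ∀ {w} → ¬ p ∣ w → 1 ≤ w
  ∤⇒≥1 {zero} p∤0 = ⊥-elim (p∤0 (p ∣0))
  ∤⇒≥1 {suc w} _ = s≤s z≤n

  ^-monoʳ-∣ : ∀ {a b} → a ≤ b → p ^ a ∣ p ^ b
  ^-monoʳ-∣ {a} {b} a≤b = divides (p ^ (b ∸ a)) (begin
    p ^ b               ≡⟨ cong (p ^_) (m+[n∸m]≡n a≤b) ⟨
    p ^ (a + (b ∸ a))   ≡⟨ ^-distribˡ-+-* p a (b ∸ a) ⟩
    p ^ a * p ^ (b ∸ a) ≡⟨ *-comm (p ^ a) (p ^ (b ∸ a)) ⟩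
    p ^ (b ∸ a) * p ^ a ∎)
    where open ≡-Reasoning

  p∣p^ : ∀ {n} → 1 ≤ n → p ∣ p ^ n
  p∣p^ {suc n} _ = m∣m*n (p ^ n)

  p∤m⇒p∤m*m : ∀ {m} → ¬ p ∣ m → ¬ p ∣ m * m
  p∤m⇒p∤m*m p∤m p∣mm with euclidsLemma _ _ pr p∣mm
  ... | inj₁ p∣m = p∤m p∣m
  ... | inj₂ p∣m = p∤m p∣m

  p^n∣m*c⇒p^n∣m : ∀ {c} → ¬ p ∣ c → ∀ n m → p ^ n ∣ m * c → p ^ n ∣ m
  p^n∣m*c⇒p^n∣m p∤c zero m _ = 1∣ m
  p^n∣m*c⇒p^n∣m {c} p∤c (suc n) m p^sn∣mc with euclidsLemma m c pr (m*n∣⇒m∣ p (p ^ n) p^sn∣mc)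
  ... | inj₂ p∣c = ⊥-elim (p∤c p∣c)
  ... | inj₁ (divides m' refl) =
    subst (_∣ m' * p) (*-comm (p ^ n) p) (*-monoˡ-∣ p (p^n∣m*c⇒p^n∣m p∤c n m' (*-cancelˡ-∣ p p^sn∣pm'c)))
    where
    p^sn∣pm'c : p * p ^ n ∣ p * (m' * c)
    p^sn∣pm'c = subst (p * p ^ n ∣_) (trans (*-assoc m' p c)
      (trans (cong (m' *_) (*-comm p c)) (trans (sym (*-assoc m' c p)) (*-comm (m' * c) p)))) p^sn∣mc

  ^-split : ∀ {k ℓ} → ℓ ≤ k → p ^ k ≡ p ^ (k ∸ ℓ) * p ^ ℓ
  ^-split {k} {ℓ} ℓ≤k = trans (cong (p ^_) (sym (m∸n+n≡m ℓ≤k))) (^-distribˡ-+-* p (k ∸ ℓ) ℓ)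

  p-adic-decomposition : ∀ y → 1 ≤ y → ∃₂ λ w j → ¬ p ∣ w × y ≡ w * p ^ j
  p-adic-decomposition = <-rec _ decompose
    where
    decompose : ∀ y → (∀ {y′} → y′ < y → 1 ≤ y′ → ∃₂ λ w j → ¬ p ∣ w × y′ ≡ w * p ^ j) →
                1 ≤ y → ∃₂ λ w j → ¬ p ∣ w × y ≡ w * p ^ j
    decompose y rec 1≤y with p ∣? y
    ... | no p∤y = y , 0 , p∤y , sym (*-identityʳ y)
    ... | yes (divides zero refl) = ⊥-elim (<-irrefl refl 1≤y)
    ... | yes (divides (suc y′) refl) with rec y′<y′p (s≤s z≤n)
      where
      y′<y′p : suc y′ < suc y′ * p
      y′<y′p = subst (_< suc y′ * p) (*-identityʳ (suc y′)) (*-monoʳ-< (suc y′) 2≤p)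
    ...   | w , j , p∤w , y′≡wp^j = w , suc j , p∤w , (begin
      suc y′ * p      ≡⟨ cong (_* p) y′≡wp^j ⟩
      w * p ^ j * p   ≡⟨ *-assoc w (p ^ j) p ⟩
      w * (p ^ j * p) ≡⟨ cong (w *_) (*-comm (p ^ j) p) ⟩
      w * p ^ suc j   ∎)
      where open ≡-Reasoning

  p^k∣a*p^i⇒k≤i : ∀ {a k i} → ¬ p ∣ a → p ^ k ∣ a * p ^ i → k ≤ i
  p^k∣a*p^i⇒k≤i {a} {k} {i} p∤a p^k∣ap^i with k ≤? i
  ... | yes k≤i = k≤i
  ... | no k≰i = ⊥-elim (p∤a (*-cancelʳ-∣ (p ^ i) {{m^n≢0 p i}} (∣-trans (^-monoʳ-∣ (≰⇒> k≰i)) p^k∣ap^i)))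

  unit-power-congruence : ∀ {a b i j k} → ¬ p ∣ a → ¬ p ∣ b → i < k → j < k →
    a * p ^ i ≡ b * p ^ j [mod p ^ k ] → i ≡ j × (a ≡ b [mod p ^ (k ∸ i) ])
  unit-power-congruence {a} {b} {i} {j} {k} p∤a p∤b i<k j<k c with <-cmp i j
  ... | tri< i<j _ _ = ⊥-elim (<-irrefl refl
          (p^k∣a*p^i⇒k≤i {i = i} p∤a
            (mod-∣ {a = b * p ^ j} (^-monoʳ-∣ i<k) (mod-sym c) (∣n⇒∣m*n b (^-monoʳ-∣ i<j)))))
  ... | tri> _ _ j<i = ⊥-elim (<-irrefl refl
          (p^k∣a*p^i⇒k≤i {i = j} p∤b
            (mod-∣ {a = a * p ^ i} (^-monoʳ-∣ j<k) c (∣n⇒∣m*n a (^-monoʳ-∣ j<i)))))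
  ... | tri≈ _ refl _ = refl , mod-*-cancel (p ^ i) {{m^n≢0 p i}}
          (subst (λ N → a * p ^ i ≡ b * p ^ i [mod N ]) (^-split (<⇒≤ i<k)) c)

module HenselLifting {p : ℕ} (pr : Prime p) (odd : ¬ 2 ∣ p) where
  open import Data.Nat as ℕ using (zero; suc; _^_)
  open import Data.Nat.Properties using (≤-antisym; ^-identityʳ)
  open import Data.Nat.Divisibility as ℕ using (_∣_)
  open import Data.Nat.Coprimality using (coprime-Bézout)
  open import Data.Nat.GCD using (module Bézout)
  open import Data.Integer using (ℤ; +_; _+_; _-_; _*_; -_; ∣_∣)
  open import Data.Integer.Properties using (pos-*; abs-*; *-assoc)
  open import Data.Integer.DivMod using (_%ℕ_; _/ℕ_; a≡a%ℕn+[a/ℕn]*n)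
  open import Data.Integer.Divisibility.Signed renaming (_∣_ to _∣ℤ_)
  open import Data.Integer.Tactic.RingSolver using (solve-∀)
  open import Data.Product using (∃; _×_; _,_; proj₁; proj₂)
  open import Data.Sum using (inj₁; inj₂)
  open import Relation.Binary.PropositionalEquality
  open import Data.Nat.Primality using (euclidsLemma)
  open PrimeProperties pr

  p∤2 : ¬ p ∣ 2
  p∤2 p∣2 with ≤-antisym (ℕ.∣⇒≤ p∣2) 2≤p
  ... | refl = odd p∣2

  p∤2w : ∀ {w} → ¬ p ∣ w → ¬ p ∣ 2 ℕ.* w
  p∤2w p∤w p∣2w with euclidsLemma 2 _ pr p∣2w
  ... | inj₁ p∣2 = p∤2 p∣2
  ... | inj₂ p∣w = p∤w p∣w

  integer-linear-solution : ∀ {c} → ¬ p ∣ c → ∀ s → ∃ λ T → + p ∣ℤ s + + c * T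
  integer-linear-solution {c} p∤c s with coprime-Bézout (∤⇒coprime p∤c)
  ... | Bézout.+- x y eq = - s * + x , divides (- s * + y) (begin
    s + + c * (- s * + x)     ≡⟨ regroup s (+ c) (+ x) ⟩
    s - s * (+ x * + c)       ≡⟨ cong (λ z → s - s * z) xc≡1+yp ⟩
    s - s * (+ 1 + + y * + p) ≡⟨ expand s (+ y) (+ p) ⟩
    - s * + y * + p           ∎)
    where
    open ≡-Reasoning
    xc≡1+yp : + x * + c ≡ + 1 + + y * + p
    xc≡1+yp = trans (sym (pos-* x c)) (trans (cong +_ (sym eq)) (pos-+-* 1 y p))
    regroup : ∀ s c x → s + c * (- s * x) ≡ s - s * (x * c)
    regroup = solve-∀
    expand : ∀ s y p → s - s * (+ 1 + y * p) ≡ - s * y * p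
    expand = solve-∀
  ... | Bézout.-+ x y eq = s * + x , divides (s * + y) (begin
    s + + c * (s * + x)       ≡⟨ regroup s (+ c) (+ x) ⟩
    s * (+ 1 + + x * + c)     ≡⟨ cong (s *_) 1+xc≡yp ⟩
    s * (+ y * + p)           ≡⟨ *-assoc s (+ y) (+ p) ⟨
    s * + y * + p             ∎)
    where
    open ≡-Reasoning
    1+xc≡yp : + 1 + + x * + c ≡ + y * + p
    1+xc≡yp = trans (sym (pos-+-* 1 x c)) (trans (cong +_ eq) (pos-* y p))
    regroup : ∀ s c x → s + c * (s * x) ≡ s * (+ 1 + x * c)
    regroup = solve-∀

  linear-congruence-solvable : ∀ {c} → ¬ p ∣ c → ∀ s → ∃ λ t → + p ∣ℤ s + + c * + t
  linear-congruence-solvable {c} p∤c s with integer-linear-solution p∤c s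
  ... | T , divides r eq = T %ℕ p , divides (r - + c * (T /ℕ p))
          (reduce s (+ c) (+ (T %ℕ p)) (T /ℕ p) (+ p) r (subst (λ T → s + + c * T ≡ r * + p) (a≡a%ℕn+[a/ℕn]*n T p) eq))
    where
    reduce : ∀ s c t Q p r → s + c * (t + Q * p) ≡ r * p → s + c * t ≡ (r - c * Q) * p
    reduce s c t Q p r e = trans (expand s c t Q p) (trans (cong (λ z → z - c * Q * p) e) (factor r c Q p))
      where
      expand : ∀ s c t Q p → s + c * t ≡ (s + c * (t + Q * p)) - c * Q * p
      expand = solve-∀
      factor : ∀ r c Q p → r * p - c * Q * p ≡ (r - c * Q) * p
      factor = solve-∀

  square-root-lift-unique : ∀ {n w₁ w₂ a} → ¬ p ∣ w₁ → w₁ ≡ w₂ [mod p ] →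
    w₁ ℕ.* w₁ ≡ a [mod p ^ n ] → w₂ ℕ.* w₂ ≡ a [mod p ^ n ] → w₁ ≡ w₂ [mod p ^ n ]
  square-root-lift-unique {n} {w₁} {w₂} {a} p∤w₁ (mod-intro w₁≡w₂) (mod-intro e₁) (mod-intro e₂) =
    mod-intro (∣ᵤ⇒∣ (p^n∣m*c⇒p^n∣m p∤sum n ∣ + w₁ - + w₂ ∣
      (subst (p ^ n ∣_) (abs-* (+ w₁ - + w₂) (+ w₁ + + w₂)) (∣⇒∣ᵤ product))))
    where
    product : + (p ^ n) ∣ℤ (+ w₁ - + w₂) * (+ w₁ + + w₂)
    product = ∣-cong (trans (cong₂ (λ u v → (u - + a) - (v - + a)) (pos-* w₁ w₁) (pos-* w₂ w₂))
                            (factor (+ w₁) (+ w₂) (+ a)))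
                     (∣m∣n⇒∣m-n e₁ e₂)
      where
      factor : ∀ x y z → (x * x - z) - (y * y - z) ≡ (x - y) * (x + y)
      factor = solve-∀
    p∤sum : ¬ p ∣ ∣ + w₁ + + w₂ ∣
    p∤sum p∣sum = p∤2w p∤w₁ (∣⇒∣ᵤ (∣-cong (trans (double (+ w₁) (+ w₂)) (sym (pos-* 2 w₁)))
                                          (∣m∣n⇒∣m+n {m = + w₁ + + w₂} (∣ᵤ⇒∣ p∣sum) w₁≡w₂)))
      where
      double : ∀ x y → (x + y) + (x - y) ≡ + 2 * x
      double = solve-∀

  private
    lifting-identity : ∀ W T A s r p q → W * W - A ≡ s * (p * q) → s + + 2 * W * T ≡ r * p →
      (W + T * (p * q)) * (W + T * (p * q)) - A ≡ (r + T * T * q) * (p * (p * q))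
    lifting-identity W T A s r p q h₁ h₂ = begin
      (W + T * (p * q)) * (W + T * (p * q)) - A                ≡⟨ expand W T A (p * q) ⟩
      (W * W - A) + + 2 * W * T * (p * q) + T * T * (p * q) * (p * q)
        ≡⟨ cong (λ z → z + + 2 * W * T * (p * q) + T * T * (p * q) * (p * q)) h₁ ⟩
      s * (p * q) + + 2 * W * T * (p * q) + T * T * (p * q) * (p * q)
        ≡⟨ collect s W T (p * q) ⟩
      (s + + 2 * W * T) * (p * q) + T * T * (p * q) * (p * q)  ≡⟨ cong (λ z → z * (p * q) + T * T * (p * q) * (p * q)) h₂ ⟩
      r * p * (p * q) + T * T * (p * q) * (p * q)              ≡⟨ factor r T p q ⟩
      (r + T * T * q) * (p * (p * q))                          ∎
      where
      open ≡-Reasoning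
      expand : ∀ W T A Q → (W + T * Q) * (W + T * Q) - A ≡ (W * W - A) + + 2 * W * T * Q + T * T * Q * Q
      expand = solve-∀
      collect : ∀ s W T Q → s * Q + + 2 * W * T * Q + T * T * Q * Q ≡ (s + + 2 * W * T) * Q + T * T * Q * Q
      collect = solve-∀
      factor : ∀ r T p q → r * p * (p * q) + T * T * (p * q) * (p * q) ≡ (r + T * T * q) * (p * (p * q))
      factor = solve-∀

  hensel-step : ∀ {n a w} → ¬ p ∣ w → w ℕ.* w ≡ a [mod p ^ suc n ] →
    ∃ λ w′ → w′ ≡ w [mod p ^ suc n ] × w′ ℕ.* w′ ≡ a [mod p ^ suc (suc n) ]
  hensel-step {n} {a} {w} p∤w (mod-intro (divides s eq)) =
    w′ , mod-+-multiple P w t , mod-intro (divides (r + + t * + t * + (p ^ n)) (begin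
      + (w′ ℕ.* w′) - + a                  ≡⟨ cong (_- + a) (pos-* w′ w′) ⟩
      + w′ * + w′ - + a                    ≡⟨ cong (λ z → z * z - + a) w′ℤ ⟩
      (+ w + + t * (+ p * + (p ^ n))) * (+ w + + t * (+ p * + (p ^ n))) - + a
        ≡⟨ lifting-identity (+ w) (+ t) (+ a) s r (+ p) (+ (p ^ n)) h₁ h₂ ⟩
      (r + + t * + t * + (p ^ n)) * (+ p * (+ p * + (p ^ n)))
        ≡⟨ cong ((r + + t * + t * + (p ^ n)) *_) (trans (pos-* p P) (cong (+ p *_) Pℤ)) ⟨
      (r + + t * + t * + (p ^ n)) * + (p ℕ.* P) ∎))
    where
    open ≡-Reasoning
    P : ℕ
    P = p ^ suc n
    solution : ∃ λ t → + p ∣ℤ s + + (2 ℕ.* w) * + t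
    solution = linear-congruence-solvable (p∤2w p∤w) s
    t : ℕ
    t = proj₁ solution
    r : ℤ
    r = _∣ℤ_.quotient (proj₂ solution)
    w′ : ℕ
    w′ = w ℕ.+ t ℕ.* P
    Pℤ : + P ≡ + p * + (p ^ n)
    Pℤ = pos-* p (p ^ n)
    w′ℤ : + w′ ≡ + w + + t * (+ p * + (p ^ n))
    w′ℤ = trans (pos-+-* w t P) (cong (λ z → + w + + t * z) Pℤ)
    h₁ : + w * + w - + a ≡ s * (+ p * + (p ^ n))
    h₁ = trans (cong (_- + a) (sym (pos-* w w))) (trans eq (cong (s *_) Pℤ))
    h₂ : s + + 2 * + w * + t ≡ r * + p
    h₂ = trans (cong (λ z → s + z * + t) (sym (pos-* 2 w))) (_∣ℤ_.equality (proj₂ solution))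

  hensel : ∀ {a z} → ¬ p ∣ z → z ℕ.* z ≡ a [mod p ] →
    ∀ n → ∃ λ w → w ≡ z [mod p ] × w ℕ.* w ≡ a [mod p ^ suc n ]
  hensel {a} {z} p∤z z²≡a zero = z , mod-refl z , mod-weaken (ℕ.∣-reflexive (^-identityʳ p)) z²≡a
  hensel {a} {z} p∤z z²≡a (suc n) =
    let w , w≡z , w²≡a = hensel p∤z z²≡a n
        w′ , w′≡w , w′²≡a = hensel-step {n} (λ p∣w → p∤z (mod-∣ ℕ.∣-refl w≡z p∣w)) w²≡a
    in w′ , mod-trans (mod-weaken (p∣p^ {suc n} (ℕ.s≤s ℕ.z≤n)) w′≡w) w≡z , w′²≡a

open import Defs
open import Data.Nat
open import Data.Nat.Properties
open import Data.Nat.DivMod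
  using (_%_; _/_; m%n<n; m≡m%n+[m/n]*n; m<n⇒m%n≡m; m%n%n≡m%n; %-distribˡ-*; m<n*o⇒m/o<n; [m+kn]%n≡m%n;
         %-remove-+ʳ; m∣n⇒o%n%m≡o%m; m*n%n≡0)
open import Data.Nat.Divisibility
open import Data.Nat.Primality using (prime⇒nonZero)
open import Data.Nat.Coprimality using (Coprime)
open import Data.Nat.Tactic.RingSolver using (solve-∀)
open import Data.List using (List; []; _∷_; map; upTo; filter; concatMap; replicate; length; lookup; _++_)
open import Data.List.Properties using (upTo-∷ʳ; filter-++; length-++; filter-accept; filter-reject)
open import Data.List.Membership.Propositional using (_∈_)
open import Data.List.Membership.Propositional.Properties
  using (∈-filter⁺; ∈-filter⁻; ∈-map⁺; ∈-map⁻; ∈-upTo⁺; ∈-upTo⁻)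
open import Data.List.Membership.DecPropositional _≟_ using (_∈?_)
open import Data.List.Relation.Unary.Any using (here; there)
open import Data.List.Relation.Unary.All using (All; _∷_)
open import Data.List.Relation.Unary.AllPairs using (_∷_)
open import Data.List.Relation.Unary.Unique.Propositional using (Unique)
import Data.List.Relation.Unary.Unique.Propositional.Properties as Unique
open import Data.Fin using (Fin; zero; suc; toℕ)
open import Data.Fin.Properties using (toℕ-injective)
open import Data.Product using (_×_; _,_; proj₁; proj₂; ∃; ∃₂)
open import Data.Sum as Sum using (_⊎_; inj₁; inj₂; [_,_]′)
open import Data.Empty using (⊥; ⊥-elim)
open import Relation.Nullary using (yes; no)
open import Relation.Binary.PropositionalEquality
open import Relation.Binary.Construct.Closure.ReflexiveTransitive using (Star; ε; _◅_; _◅◅_)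
open import Relation.Binary.Construct.Closure.Transitive using (TransClosure; [_]; _∷_)

mod≡% : ∀ a n .{{_ : NonZero n}} → a mod n ≡ a % n
mod≡% a (suc n) = refl

square-* : ∀ a b → (a * b) * (a * b) ≡ (a * a) * (b * b)
square-* = solve-∀

square-*-^ : ∀ w b j → (w * b ^ j) * (w * b ^ j) ≡ (w * w) * b ^ (j + j)
square-*-^ w b j = trans (square-* w (b ^ j)) (cong ((w * w) *_) (sym (^-distribˡ-+-* b j j)))

∣∧<⇒≡0 : ∀ {n x} → n ∣ x → x < n → x ≡ 0
∣∧<⇒≡0 {x = zero} _ _ = refl
∣∧<⇒≡0 {x = suc x} n∣x x<n = ⊥-elim (<⇒≱ x<n (∣⇒≤ n∣x))

module NilpotentPart {p : ℕ} (pr : Prime p) (k : ℕ) (1≤k : 1 ≤ k) where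
  open PrimeProperties pr

  q : ℕ
  q = p ^ k

  instance
    q≢0 : NonZero q
    q≢0 = m^n≢0 p k

  edge-target : ∀ {a b} → NEdge p k a b → b ≡ (a * a) % q
  edge-target {a} (_ , _ , _ , b≡a²) = trans b≡a² (mod≡% (a * a) q)

  square-closed : ∀ x → NVert p k x → NVert p k ((x * x) mod q)
  square-closed x (_ , p∣x) = subst (NVert p k) (sym (mod≡% (x * x) q))
    (m%n<n (x * x) q , %-presˡ-∣ (∣m⇒∣m*n x p∣x) (p∣p^ 1≤k))

  0-vertex : NVert p k 0
  0-vertex = m^n>0 p k , p ∣0

  0-loop : NEdge p k 0 0
  0-loop = 0-vertex , 0-vertex , m^n>0 p k , sym (trans (mod≡% 0 q) (m<n⇒m%n≡m (m^n>0 p k)))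

  square-edge : ∀ {x} → NVert p k x → NEdge p k x ((x * x) mod q)
  square-edge {x} xv = xv , square-closed x xv , proj₁ xv , refl

  edge-preserves-∣ : ∀ {a b j} → NEdge p k a b → j ≤ k → p ^ j ∣ a → p ^ j ∣ b
  edge-preserves-∣ {a} e j≤k p^j∣a =
    subst (_ ∣_) (sym (edge-target e)) (%-presˡ-∣ (∣m⇒∣m*n a p^j∣a) (^-monoʳ-∣ j≤k))

  edge-raises-∣ : ∀ {a b j} → NEdge p k a b → 1 ≤ j → j < k → p ^ j ∣ a → p ^ suc j ∣ b
  edge-raises-∣ {a} {b} {j} e 1≤j j<k p^j∣a = subst (_ ∣_) (sym (edge-target e))
    (%-presˡ-∣ (∣-trans p^sj∣p^jp^j (*-pres-∣ p^j∣a p^j∣a)) (^-monoʳ-∣ j<k))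
    where
    p^sj∣p^jp^j : p ^ suc j ∣ p ^ j * p ^ j
    p^sj∣p^jp^j = subst (p ^ suc j ∣_) (^-distribˡ-+-* p j j) (^-monoʳ-∣ (+-monoˡ-≤ j 1≤j))

  path⁺-raises-∣ : ∀ {a b j} → TransClosure (NEdge p k) a b → 1 ≤ j → j < k → p ^ j ∣ a → p ^ suc j ∣ b
  path⁺-raises-∣ [ e ] 1≤j j<k p^j∣a = edge-raises-∣ e 1≤j j<k p^j∣a
  path⁺-raises-∣ (e ∷ r) 1≤j j<k p^j∣a = path⁺-raises-∣ r 1≤j j<k (edge-preserves-∣ e (<⇒≤ j<k) p^j∣a)

  acyclic : ∀ x → NVert p k x → x ≢ 0 → ¬ TransClosure (NEdge p k) x x
  acyclic x (x<q , p∣x) x≢0 cycle = x≢0 (∣∧<⇒≡0 (p^j∣x k ≤-refl) x<q)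
    where
    p^j∣x : ∀ j → j ≤ k → p ^ j ∣ x
    p^j∣x zero _ = 1∣ x
    p^j∣x (suc zero) _ = subst (_∣ x) (sym (*-identityʳ p)) p∣x
    p^j∣x (suc (suc j)) j+2≤k = path⁺-raises-∣ cycle (s≤s z≤n) j+2≤k (p^j∣x (suc j) (<⇒≤ j+2≤k))

  path-to-0 : ∀ x → NVert p k x → Star (NEdge p k) x 0
  path-to-0 x xv = iterate k x xv 1 (s≤s z≤n) (subst (_∣ x) (sym (*-identityʳ p)) (proj₂ xv)) (n≤1+n k)
    where
    iterate : ∀ s x → NVert p k x → ∀ j → 1 ≤ j → p ^ j ∣ x → k ≤ j + s → Star (NEdge p k) x 0
    iterate s x xv j 1≤j p^j∣x k≤j+s with k ≤? j
    ... | yes k≤j = subst (λ z → Star (NEdge p k) z 0) (sym (∣∧<⇒≡0 (∣-trans (^-monoʳ-∣ k≤j) p^j∣x) (proj₁ xv))) ε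
    iterate zero x xv j 1≤j p^j∣x k≤j+0 | no k≰j = ⊥-elim (k≰j (subst (k ≤_) (+-identityʳ j) k≤j+0))
    iterate (suc s) x xv j 1≤j p^j∣x k≤j+s | no k≰j =
      square-edge xv ◅ iterate s _ (square-closed x xv) (suc j) (s≤s z≤n)
                  (edge-raises-∣ (square-edge xv) 1≤j (≰⇒> k≰j) p^j∣x) (subst (k ≤_) (+-suc j s) k≤j+s)

  exponent<k : ∀ {x x̃ ℓ} → 1 ≤ x → x < q → x ≡ x̃ * p ^ ℓ → ℓ < k
  exponent<k {x} {x̃} {ℓ} 1≤x x<q x≡x̃p^ℓ with ℓ <? k
  ... | yes ℓ<k = ℓ<k
  ... | no ℓ≮k = ⊥-elim (<⇒≢ 1≤x (sym (∣∧<⇒≡0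
          (subst (q ∣_) (sym x≡x̃p^ℓ) (∣n⇒∣m*n x̃ (^-monoʳ-∣ (≮⇒≥ ℓ≮k)))) x<q)))

  edge-into-0⇒ : ∀ x → (NVert p k x × x ≢ 0 × NEdge p k x 0) →
    ∃₂ λ y ℓ → k ≤ 2 * ℓ × ℓ < k × 1 ≤ y × y ≤ p ^ (k ∸ ℓ) × Coprime y p × x ≡ y * p ^ ℓ
  edge-into-0⇒ x ((x<q , _) , x≢0 , e) with p-adic-decomposition x (n≢0⇒n>0 x≢0)
  ... | w , j , p∤w , x≡wp^j =
        w , j , k≤2j , j<k , ∤⇒≥1 p∤w , <⇒≤ w<p^[k∸j] , ∤⇒coprime p∤w , x≡wp^j
    where
    j<k : j < k
    j<k = exponent<k {x̃ = w} (n≢0⇒n>0 x≢0) x<q x≡wp^j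
    q∣w²p^2j : q ∣ (w * w) * p ^ (j + j)
    q∣w²p^2j = subst (q ∣_) (trans (cong (λ z → z * z) x≡wp^j) (square-*-^ w p j))
                     (m%n≡0⇒n∣m (x * x) q (sym (edge-target e)))
    k≤2j : k ≤ 2 * j
    k≤2j = subst (λ i → k ≤ j + i) (sym (+-identityʳ j)) (p^k∣a*p^i⇒k≤i (p∤m⇒p∤m*m p∤w) q∣w²p^2j)
    w<p^[k∸j] : w < p ^ (k ∸ j)
    w<p^[k∸j] = *-cancelʳ-< (p ^ j) w (p ^ (k ∸ j)) (subst₂ _<_ x≡wp^j (^-split (<⇒≤ j<k)) x<q)

  edge-into-0⇐ : ∀ y ℓ → k ≤ 2 * ℓ → ℓ < k → 1 ≤ y → y ≤ p ^ (k ∸ ℓ) → Coprime y p →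
    NVert p k (y * p ^ ℓ) × y * p ^ ℓ ≢ 0 × NEdge p k (y * p ^ ℓ) 0
  edge-into-0⇐ y ℓ k≤2ℓ ℓ<k 1≤y y≤p^[k∸ℓ] y⊥p = xv , m<n⇒n≢0 1≤x , (xv , 0-vertex , x<q , sym x²≡0)
    where
    x : ℕ
    x = y * p ^ ℓ
    p∤y : ¬ p ∣ y
    p∤y = coprime⇒∤ y⊥p
    1≤ℓ : 1 ≤ ℓ
    1≤ℓ = n≢0⇒n>0 (λ ℓ≡0 → <⇒≱ 1≤k (subst (λ e → k ≤ 2 * e) ℓ≡0 k≤2ℓ))
    y<p^[k∸ℓ] : y < p ^ (k ∸ ℓ)
    y<p^[k∸ℓ] = ≤∧≢⇒< y≤p^[k∸ℓ] (λ y≡p^ → p∤y (subst (p ∣_) (sym y≡p^) (p∣p^ (m<n⇒0<n∸m ℓ<k))))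
    x<q : x < q
    x<q = subst (x <_) (sym (^-split (<⇒≤ ℓ<k))) (*-monoˡ-< (p ^ ℓ) {{m^n≢0 p ℓ}} y<p^[k∸ℓ])
    1≤x : 1 ≤ x
    1≤x = *-mono-≤ 1≤y (m^n>0 p ℓ)
    xv : NVert p k x
    xv = x<q , ∣n⇒∣m*n y (p∣p^ 1≤ℓ)
    x²≡0 : (x * x) mod q ≡ 0
    x²≡0 = trans (mod≡% (x * x) q) (n∣m⇒m%n≡0 (x * x) q (subst (q ∣_) (sym (square-*-^ y p ℓ))
             (∣n⇒∣m*n (y * y) (^-monoʳ-∣ (subst (λ i → k ≤ ℓ + i) (+-identityʳ ℓ) k≤2ℓ)))))

module Multiples (p : ℕ) .{{_ : NonZero p}} where

  multiplesBelow : ℕ → ℕ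
  multiplesBelow n = length (filter (p ∣?_) (upTo n))

  multiplesBelow-suc : ∀ n → multiplesBelow (suc n) ≡ multiplesBelow n + length (filter (p ∣?_) (n ∷ []))
  multiplesBelow-suc n = begin
    length (filter (p ∣?_) (upTo (suc n)))                  ≡⟨ cong (λ l → length (filter (p ∣?_) l)) (upTo-∷ʳ n) ⟨
    length (filter (p ∣?_) (upTo n ++ (n ∷ [])))       ≡⟨ cong length (filter-++ (p ∣?_) (upTo n) (n ∷ [])) ⟩
    length (filter (p ∣?_) (upTo n) ++ filter (p ∣?_) (n ∷ [])) ≡⟨ length-++ (filter (p ∣?_) (upTo n)) ⟩
    multiplesBelow n + length (filter (p ∣?_) (n ∷ []))     ∎
    where open ≡-Reasoning

  multiplesBelow-suc-∣ : ∀ n → p ∣ n → multiplesBelow (suc n) ≡ suc (multiplesBelow n)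
  multiplesBelow-suc-∣ n p∣n = trans (multiplesBelow-suc n)
    (trans (cong (λ l → multiplesBelow n + length l) (filter-accept (p ∣?_) p∣n)) (+-comm (multiplesBelow n) 1))

  multiplesBelow-suc-∤ : ∀ n → ¬ p ∣ n → multiplesBelow (suc n) ≡ multiplesBelow n
  multiplesBelow-suc-∤ n p∤n = trans (multiplesBelow-suc n)
    (trans (cong (λ l → multiplesBelow n + length l) (filter-reject (p ∣?_) p∤n)) (+-identityʳ (multiplesBelow n)))

  mutual
    multiplesBelow-* : ∀ m → multiplesBelow (m * p) ≡ m
    multiplesBelow-* zero = refl
    multiplesBelow-* (suc m) = trans (cong multiplesBelow m*p+p) (multiplesBelow-*-+ m (pred p) ≤-refl)
      where
      m*p+p : suc m * p ≡ m * p + suc (pred p)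
      m*p+p = trans (+-comm p (m * p)) (cong (m * p +_) (sym (suc-pred p)))

    multiplesBelow-*-+ : ∀ m r → r ≤ pred p → multiplesBelow (m * p + suc r) ≡ suc m
    multiplesBelow-*-+ m zero _ = trans (cong multiplesBelow (+-comm (m * p) 1))
      (trans (multiplesBelow-suc-∣ (m * p) (n∣m*n m)) (cong suc (multiplesBelow-* m)))
    multiplesBelow-*-+ m (suc r) r<p = trans (cong multiplesBelow (+-suc (m * p) (suc r)))
      (trans (multiplesBelow-suc-∤ (m * p + suc r) p∤) (multiplesBelow-*-+ m r (≤-trans (n≤1+n r) r<p)))
      where
      p∤ : ¬ p ∣ m * p + suc r
      p∤ p∣ = <⇒≱ (subst (suc (suc r) ≤_) (suc-pred p) (s≤s r<p)) (∣⇒≤ (∣m+n∣m⇒∣n p∣ (n∣m*n m)))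

  multiplesBelow-^ : ∀ k → 1 ≤ k → multiplesBelow (p ^ k) ≡ p ^ (k ∸ 1)
  multiplesBelow-^ (suc k) _ = trans (cong multiplesBelow (*-comm p (p ^ k))) (multiplesBelow-* (p ^ k))

module InTreeGluing (p k : ℕ) where
  private
    E : ℕ → ℕ → Set
    E = NEdge p k

  edge-deterministic : ∀ {a b b′} → E a b → E a b′ → b ≡ b′
  edge-deterministic (_ , _ , _ , b≡a²) (_ , _ , _ , b′≡a²) = trans b≡a² (sym b′≡a²)

  paths-comparable : ∀ {y u v} → Star E y u → Star E y v → Star E u v ⊎ Star E v u
  paths-comparable ε r = inj₁ r
  paths-comparable (e ◅ r) ε = inj₂ (e ◅ r)
  paths-comparable (e ◅ r) (e′ ◅ r′) with edge-deterministic e e′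
  ... | refl = paths-comparable r r′

  star-cases : ∀ {y z} → Star E y z → y ≡ z ⊎ ∃ λ w → E y w × Star E w z
  star-cases ε = inj₁ refl
  star-cases (e ◅ r) = inj₂ (_ , e , r)

  _◅◅⁺_ : ∀ {a b c} → Star E a b → E b c → TransClosure E a c
  ε ◅◅⁺ e = [ e ]
  (e′ ◅ r) ◅◅⁺ e = e′ ∷ (r ◅◅⁺ e)

  -- Since squaring is a function, the in-trees of distinct children are disjoint,
  -- and they avoid x because x lies on no cycle.
  module _ (x : ℕ) (xv : NVert p k x) (acyclic : ¬ TransClosure E x x)
           (ts : List RTree) (c : Fin (length ts) → ℕ)
           (c-injective : ∀ i j → c i ≡ c j → i ≡ j)
           (c-edge : ∀ i → E (c i) x)
           (c-surjective : ∀ y → NVert p k y → E y x → ∃ λ i → c i ≡ y)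
           (c-iso : ∀ i → InTreeIso p k (c i) (lookup ts i)) where

    open InTreeIso

    private
      children-unrelated : ∀ i j → Star E (c i) (c j) → c i ≡ c j
      children-unrelated i j s with star-cases s
      ... | inj₁ eq = eq
      ... | inj₂ (_ , e , r) with edge-deterministic e (c-edge i)
      ...   | refl = ⊥-elim (acyclic (r ◅◅⁺ c-edge j))

      same-child : ∀ {a} i j → Star E a (c i) → Star E a (c j) → i ≡ j
      same-child i j r r′ with paths-comparable r r′
      ... | inj₁ s = c-injective i j (children-unrelated i j s)
      ... | inj₂ s = c-injective i j (sym (children-unrelated j i s))

      below-child : ∀ i a → Star E (φ (c-iso i) a) x
      below-child i a = proj₂ (φ-into (c-iso i) a) ◅◅ (c-edge i ◅ ε)

      φ′ : Pos (node ts) → ℕ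
      φ′ root = x
      φ′ (child i a) = φ (c-iso i) a

      child≢root : ∀ i a → φ (c-iso i) a ≢ x
      child≢root i a eq with φ-into (c-iso i) a
      ... | _ , r rewrite eq = acyclic (r ◅◅⁺ c-edge i)

      in-tree-cases : ∀ {y} → NVert p k y → Star E y x → y ≡ x ⊎ ∃ λ i → InTree p k (c i) y
      in-tree-cases yv ε = inj₁ refl
      in-tree-cases yv (e ◅ r) with in-tree-cases (proj₁ (proj₂ e)) r
      ... | inj₂ (i , v , r′) = inj₂ (i , yv , e ◅ r′)
      ... | inj₁ refl with c-surjective _ yv e
      ...   | i , refl = inj₂ (i , yv , ε)

      φ′-injective : ∀ a b → φ′ a ≡ φ′ b → a ≡ b
      φ′-injective root root _ = refl
      φ′-injective root (child i b) eq = ⊥-elim (child≢root i b (sym eq))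
      φ′-injective (child i a) root eq = ⊥-elim (child≢root i a eq)
      φ′-injective (child i a) (child j b) eq
        with same-child i j (proj₂ (φ-into (c-iso i) a)) (subst (λ z → Star E z (c j)) (sym eq) (proj₂ (φ-into (c-iso j) b)))
      ... | refl = cong (child i) (φ-inj (c-iso i) a b eq)

      φ′-into : ∀ a → InTree p k x (φ′ a)
      φ′-into root = xv , ε
      φ′-into (child i a) = proj₁ (φ-into (c-iso i) a) , below-child i a

      φ′-onto : ∀ y → InTree p k x y → ∃ λ a → φ′ a ≡ y
      φ′-onto y (yv , r) with in-tree-cases yv r
      ... | inj₁ refl = root , refl
      ... | inj₂ (i , t) with φ-onto (c-iso i) y t
      ...   | a , eq = child i a , eq

      φ′-hom : ∀ a b → TEdge a b → E (φ′ a) (φ′ b)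
      φ′-hom _ _ (top {i = i}) = subst (λ z → E z x) (sym (φ-root (c-iso i))) (c-edge i)
      φ′-hom _ _ (down {i = i} {a} {b} t) = φ-hom (c-iso i) a b t

      φ′-refl : ∀ a b → E (φ′ a) (φ′ b) → TEdge a b
      φ′-refl root root e = ⊥-elim (acyclic [ e ])
      φ′-refl root (child i b) e = ⊥-elim (acyclic (e ∷ (proj₂ (φ-into (c-iso i) b) ◅◅⁺ c-edge i)))
      φ′-refl (child i a) root e with star-cases (proj₂ (φ-into (c-iso i) a))
      ... | inj₁ eq with φ-inj (c-iso i) a root (trans eq (sym (φ-root (c-iso i))))
      ...   | refl = top
      φ′-refl (child i a) root e | inj₂ (_ , e′ , r) with edge-deterministic e e′
      ... | refl = ⊥-elim (acyclic (r ◅◅⁺ c-edge i))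
      φ′-refl (child i a) (child j b) e with same-child i j (proj₂ (φ-into (c-iso i) a)) (e ◅ proj₂ (φ-into (c-iso j) b))
      ... | refl = down (φ-refl (c-iso i) a b e)

    in-tree-node : InTreeIso p k x (node ts)
    in-tree-node = record
      { φ = φ′ ; φ-root = refl ; φ-inj = φ′-injective ; φ-into = φ′-into
      ; φ-onto = φ′-onto ; φ-hom = φ′-hom ; φ-refl = φ′-refl }

module _ {A : Set} where

  split-++ : ∀ (xs ys : List A) → Fin (length (xs ++ ys)) → Fin (length xs) ⊎ Fin (length ys)
  split-++ [] ys i = inj₂ i
  split-++ (x ∷ xs) ys zero = inj₁ zero
  split-++ (x ∷ xs) ys (suc i) = Sum.map₁ suc (split-++ xs ys i)

  lookup-split-++ : ∀ xs ys i → lookup (xs ++ ys) i ≡ [ lookup xs , lookup ys ]′ (split-++ xs ys i)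
  lookup-split-++ [] ys i = refl
  lookup-split-++ (x ∷ xs) ys zero = refl
  lookup-split-++ (x ∷ xs) ys (suc i) with split-++ xs ys i | lookup-split-++ xs ys i
  ... | inj₁ _ | eq = eq
  ... | inj₂ _ | eq = eq

  split-++-injective : ∀ xs ys i i′ → split-++ xs ys i ≡ split-++ xs ys i′ → i ≡ i′
  split-++-injective [] ys i i′ refl = refl
  split-++-injective (x ∷ xs) ys zero zero eq = refl
  split-++-injective (x ∷ xs) ys zero (suc i′) eq with split-++ xs ys i′
  split-++-injective (x ∷ xs) ys zero (suc i′) () | inj₁ _
  split-++-injective (x ∷ xs) ys zero (suc i′) () | inj₂ _
  split-++-injective (x ∷ xs) ys (suc i) zero eq with split-++ xs ys i
  split-++-injective (x ∷ xs) ys (suc i) zero () | inj₁ _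
  split-++-injective (x ∷ xs) ys (suc i) zero () | inj₂ _
  split-++-injective (x ∷ xs) ys (suc i) (suc i′) eq =
    cong suc (split-++-injective xs ys i i′ (map₁-suc-injective (split-++ xs ys i) (split-++ xs ys i′) eq))
    where
    map₁-suc-injective : ∀ (u v : Fin (length xs) ⊎ Fin (length ys)) → Sum.map₁ suc u ≡ Sum.map₁ suc v → u ≡ v
    map₁-suc-injective (inj₁ a) (inj₁ .a) refl = refl
    map₁-suc-injective (inj₂ a) (inj₂ .a) refl = refl

  split-++-inj₁ : ∀ xs ys t → ∃ λ i → split-++ xs ys i ≡ inj₁ t
  split-++-inj₁ (x ∷ xs) ys zero = zero , refl
  split-++-inj₁ (x ∷ xs) ys (suc t) with split-++-inj₁ xs ys t
  ... | i , eq = suc i , cong (Sum.map₁ suc) eq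

  split-++-inj₂ : ∀ xs ys t → ∃ λ i → split-++ xs ys i ≡ inj₂ t
  split-++-inj₂ [] ys t = t , refl
  split-++-inj₂ (x ∷ xs) ys t with split-++-inj₂ xs ys t
  ... | i , eq = suc i , cong (Sum.map₁ suc) eq

  lookup-replicate′ : ∀ n (x : A) i → lookup (replicate n x) i ≡ x
  lookup-replicate′ (suc n) x zero = refl
  lookup-replicate′ (suc n) x (suc i) = lookup-replicate′ n x i

  toℕ-replicate< : ∀ n (x : A) (i : Fin (length (replicate n x))) → toℕ i < n
  toℕ-replicate< (suc n) x zero = s≤s z≤n
  toℕ-replicate< (suc n) x (suc i) = s≤s (toℕ-replicate< n x i)

  toℕ-replicate-surjective : ∀ n (x : A) j → j < n → ∃ λ (i : Fin (length (replicate n x))) → toℕ i ≡ j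
  toℕ-replicate-surjective (suc n) x zero _ = zero , refl
  toℕ-replicate-surjective (suc n) x (suc j) (s≤s j<n) with toℕ-replicate-surjective n x j j<n
  ... | i , eq = suc i , cong suc eq

-- The positions of concatMap (λ z → replicate N (g z)) Z are the pairs (z ∈ Z, j < N); label sends them to C z j.
module ConcatReplicate {A : Set} (N : ℕ) (g : ℕ → A) (C : ℕ → ℕ → ℕ) where

  copies : ℕ → List A
  copies z = replicate N (g z)

  label : ∀ Z → Fin (length (concatMap copies Z)) → ℕ
  label (z ∷ Z) i = [ (λ t → C z (toℕ t)) , label Z ]′ (split-++ (copies z) (concatMap copies Z) i)

  label-spec : ∀ Z i → ∃ λ z → ∃ λ j → z ∈ Z × j < N × lookup (concatMap copies Z) i ≡ g z × label Z i ≡ C z j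
  label-spec (z ∷ Z) i with split-++ (copies z) (concatMap copies Z) i | lookup-split-++ (copies z) (concatMap copies Z) i
  ... | inj₁ t | eq = z , toℕ t , here refl , toℕ-replicate< N (g z) t , trans eq (lookup-replicate′ N (g z) t) , refl
  ... | inj₂ t | eq with label-spec Z t
  ...   | z′ , j , z′∈Z , j<N , lookup≡ , label≡ = z′ , j , there z′∈Z , j<N , trans eq lookup≡ , label≡

  label-surjective : ∀ Z z j → z ∈ Z → j < N → ∃ λ i → label Z i ≡ C z j
  label-surjective (z ∷ Z) .z j (here refl) j<N with toℕ-replicate-surjective N (g z) j j<N
  ... | t , toℕt≡j with split-++-inj₁ (copies z) (concatMap copies Z) t
  ...   | i , eq = i , trans (cong [ (λ t → C z (toℕ t)) , label Z ]′ eq) (cong (C z) toℕt≡j)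
  label-surjective (z ∷ Z) z′ j (there z′∈Z) j<N with label-surjective Z z′ j z′∈Z j<N
  ... | t , label≡ with split-++-inj₂ (copies z) (concatMap copies Z) t
  ...   | i , eq = i , trans (cong [ (λ t → C z (toℕ t)) , label Z ]′ eq) label≡

  module _ (Z₀ : List ℕ)
           (C-injective : ∀ z z′ j j′ → z ∈ Z₀ → z′ ∈ Z₀ → j < N → j′ < N →
                          C z j ≡ C z′ j′ → z ≡ z′ × j ≡ j′) where

    private
      label-avoids : ∀ z Z → z ∈ Z₀ → (∀ {u} → u ∈ Z → u ∈ Z₀) → All (z ≢_) Z →
                     ∀ t i → t < N → C z t ≡ label Z i → ⊥
      label-avoids z Z z∈Z₀ Z⊆Z₀ z∉Z t i t<N eq with label-spec Z i
      ... | z′ , j , z′∈Z , j<N , _ , label≡ =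
            distinct z∉Z z′∈Z (proj₁ (C-injective z z′ t j z∈Z₀ (Z⊆Z₀ z′∈Z) t<N j<N (trans eq label≡)))
        where
        distinct : ∀ {Z z′} → All (z ≢_) Z → z′ ∈ Z → z ≢ z′
        distinct (z≢ ∷ _) (here refl) = z≢
        distinct (_ ∷ z∉Z) (there z′∈Z) = distinct z∉Z z′∈Z

    label-injective : ∀ Z → (∀ {u} → u ∈ Z → u ∈ Z₀) → Unique Z →
                      ∀ i i′ → label Z i ≡ label Z i′ → i ≡ i′
    label-injective (z ∷ Z) Z⊆Z₀ (z∉Z ∷ unique) i i′ eq
      with split-++ (copies z) (concatMap copies Z) i in e | split-++ (copies z) (concatMap copies Z) i′ in e′
    ... | inj₁ t | inj₁ t′ = split-++-injective (copies z) _ i i′ (trans e (trans (cong inj₁ (toℕ-injective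
           (proj₂ (C-injective z z (toℕ t) (toℕ t′) z∈Z₀ z∈Z₀
                               (toℕ-replicate< N (g z) t) (toℕ-replicate< N (g z) t′) eq))))
           (sym e′)))
      where z∈Z₀ = Z⊆Z₀ (here refl)
    ... | inj₁ t | inj₂ t′ = ⊥-elim (label-avoids z Z (Z⊆Z₀ (here refl)) (λ u∈Z → Z⊆Z₀ (there u∈Z)) z∉Z
                                                 (toℕ t) t′ (toℕ-replicate< N (g z) t) eq)
    ... | inj₂ t | inj₁ t′ = ⊥-elim (label-avoids z Z (Z⊆Z₀ (here refl)) (λ u∈Z → Z⊆Z₀ (there u∈Z)) z∉Z
                                                 (toℕ t′) t (toℕ-replicate< N (g z) t′) (sym eq))
    ... | inj₂ t | inj₂ t′ = split-++-injective (copies z) _ i i′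
           (trans e (trans (cong inj₂ (label-injective Z (λ u∈Z → Z⊆Z₀ (there u∈Z)) unique t t′ eq)) (sym e′)))

even-or-odd : ∀ ℓ → (∃ λ m → ℓ ≡ m + m) ⊎ (∃ λ m → ℓ ≡ suc (m + m))
even-or-odd zero = inj₁ (0 , refl)
even-or-odd (suc zero) = inj₂ (0 , refl)
even-or-odd (suc (suc ℓ)) with even-or-odd ℓ
... | inj₁ (m , ℓ≡2m) = inj₁ (suc m , cong suc (trans (cong suc ℓ≡2m) (sym (+-suc m m))))
... | inj₂ (m , ℓ≡2m+1) = inj₂ (suc m , cong (λ n → suc (suc n)) (trans ℓ≡2m+1 (sym (+-suc m m))))

[m+m]%2≡0 : ∀ m → (m + m) % 2 ≡ 0
[m+m]%2≡0 m = trans (cong (_% 2) (trans (cong (m +_) (sym (+-identityʳ m))) (*-comm 2 m))) (m*n%n≡0 m 2)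

[1+m+m]%2≡1 : ∀ m → suc (m + m) % 2 ≡ 1
[1+m+m]%2≡1 m = trans (cong (λ n → suc n % 2) (trans (cong (m +_) (sym (+-identityʳ m))) (*-comm 2 m))) ([m+kn]%n≡m%n 1 m 2)

m+m≢1+n+n : ∀ m n → m + m ≢ suc (n + n)
m+m≢1+n+n m n eq with trans (sym ([m+m]%2≡0 m)) (trans (cong (_% 2) eq) ([1+m+m]%2≡1 n))
... | ()

+-double-injective : ∀ m n → m + m ≡ n + n → m ≡ n
+-double-injective m n eq = trans (n≡⌊n+n/2⌋ m) (trans (cong ⌊_/2⌋ eq) (sym (n≡⌊n+n/2⌋ n)))

𝒯-fuel-odd : ∀ p f x m → 𝒯-fuel p (suc f) x (suc (m + m)) ≡ node []
𝒯-fuel-odd p f x m rewrite [1+m+m]%2≡1 m = refl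

𝒯-fuel-even : ∀ p f x m → 𝒯-fuel p (suc f) x (m + m) ≡
              node (concatMap (λ z → replicate (p ^ m) (𝒯-fuel p f z m)) (sqrts p x))
𝒯-fuel-even p f x m rewrite [m+m]%2≡0 m | sym (n≡⌊n+n/2⌋ m) = refl

module SquareRootList (p : ℕ) .{{_ : NonZero p}} where

  mod-mod : ∀ a → (a mod p) mod p ≡ a % p
  mod-mod a = trans (mod≡% (a mod p) p) (trans (cong (_% p) (mod≡% a p)) (m%n%n≡m%n a p))

  ∈-sqrts⁻ : ∀ {a z} → z ∈ sqrts p (a mod p) → 1 ≤ z × z < p × (z * z) % p ≡ a % p
  ∈-sqrts⁻ {a} {z} z∈ with ∈-filter⁻ (λ z → ((z * z) mod p) ≟ ((a mod p) mod p)) {xs = map suc (upTo (p ∸ 1))} z∈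
  ... | z∈range , z²≡a with ∈-map⁻ suc z∈range
  ...   | i , i∈ , refl = s≤s z≤n , subst (suc (suc i) ≤_) (m+[n∸m]≡n (>-nonZero⁻¹ p)) (s≤s (∈-upTo⁻ i∈)) ,
                          trans (sym (mod≡% (z * z) p)) (trans z²≡a (mod-mod a))

  ∈-sqrts⁺ : ∀ {a z} → 1 ≤ z → z < p → (z * z) % p ≡ a % p → z ∈ sqrts p (a mod p)
  ∈-sqrts⁺ {a} {suc i} _ z<p z²≡a = ∈-filter⁺ (λ z → ((z * z) mod p) ≟ ((a mod p) mod p))
    (∈-map⁺ suc (∈-upTo⁺ (∸-monoˡ-≤ 1 z<p)))
    (trans (mod≡% (suc i * suc i) p) (trans z²≡a (sym (mod-mod a))))

  sqrts-unique : ∀ a → Unique (sqrts p a)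
  sqrts-unique a = Unique.filter⁺ (λ z → ((z * z) mod p) ≟ (a mod p)) (Unique.map⁺ suc-injective (Unique.upTo⁺ (p ∸ 1)))

module InTrees {p : ℕ} (pr : Prime p) (odd : ¬ 2 ∣ p) (k : ℕ) (1≤k : 1 ≤ k) where
  open PrimeProperties pr
  open HenselLifting pr odd
  open NilpotentPart pr k 1≤k
  open SquareRootList p

  unit*p^≥1 : ∀ {x̃} ℓ → ¬ p ∣ x̃ → 1 ≤ x̃ * p ^ ℓ
  unit*p^≥1 ℓ p∤x̃ = *-mono-≤ (∤⇒≥1 p∤x̃) (m^n>0 p ℓ)

  unit-square-preimage : ∀ {w j x̃ ℓ} → ¬ p ∣ w → ¬ p ∣ x̃ → ℓ < k → ((w * w) * p ^ (j + j)) % q ≡ x̃ * p ^ ℓ →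
    j + j ≡ ℓ × (w * w ≡ x̃ [mod p ^ (k ∸ ℓ) ])
  unit-square-preimage {w} {j} {x̃} {ℓ} p∤w p∤x̃ ℓ<k y²≡x with j + j <? k
  ... | no 2j≮k = ⊥-elim (<⇒≢ (unit*p^≥1 ℓ p∤x̃) (trans (sym (n∣m⇒m%n≡0 _ q q∣y²)) y²≡x))
    where
    q∣y² : q ∣ (w * w) * p ^ (j + j)
    q∣y² = ∣n⇒∣m*n (w * w) (^-monoʳ-∣ (≮⇒≥ 2j≮k))
  ... | yes 2j<k with unit-power-congruence (p∤m⇒p∤m*m p∤w) p∤x̃ 2j<k ℓ<k
                        (subst (λ x → (w * w) * p ^ (j + j) ≡ x [mod q ]) y²≡x (mod-% _ q))
  ...   | refl , w²≡x̃ = refl , w²≡x̃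

  square-preimage : ∀ {y x̃ ℓ} → ¬ p ∣ x̃ → ℓ < k → (y * y) % q ≡ x̃ * p ^ ℓ →
    ∃₂ λ w m → ℓ ≡ m + m × y ≡ w * p ^ m × (w * w ≡ x̃ [mod p ^ (k ∸ ℓ) ])
  square-preimage {zero} {x̃} {ℓ} p∤x̃ ℓ<k y²≡x =
    ⊥-elim (<⇒≢ (unit*p^≥1 ℓ p∤x̃) (trans (sym (m<n⇒m%n≡m (m^n>0 p k))) y²≡x))
  square-preimage {y@(suc _)} {x̃} {ℓ} p∤x̃ ℓ<k y²≡x with p-adic-decomposition y (s≤s z≤n)
  ... | w , m , p∤w , y≡wp^m
    with unit-square-preimage {j = m} p∤w p∤x̃ ℓ<k
           (trans (cong (_% q) (sym (trans (cong (λ z → z * z) y≡wp^m) (square-*-^ w p m)))) y²≡x)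
  ...   | 2m≡ℓ , w²≡x̃ = w , m , sym 2m≡ℓ , y≡wp^m , w²≡x̃

  module Children (m x̃ : ℕ) (1≤m : 1 ≤ m) (p∤x̃ : ¬ p ∣ x̃) (x<q : x̃ * p ^ (m + m) < q) where
    ℓ : ℕ
    ℓ = m + m
    x : ℕ
    x = x̃ * p ^ ℓ
    P : ℕ
    P = p ^ (k ∸ ℓ)
    N : ℕ
    N = p ^ m
    Z : List ℕ
    Z = sqrts p (x̃ mod p)

    instance
      P≢0 : NonZero P
      P≢0 = m^n≢0 p (k ∸ ℓ)
      N≢0 : NonZero N
      N≢0 = m^n≢0 p m

    ℓ<k : ℓ < k
    ℓ<k = exponent<k {x̃ = x̃} (unit*p^≥1 ℓ p∤x̃) x<q refl

    p∣P : p ∣ P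
    p∣P = p∣p^ (m<n⇒0<n∸m ℓ<k)

    q≡N*P*N : q ≡ N * P * N
    q≡N*P*N = trans (^-split (<⇒≤ ℓ<k)) (trans (cong (P *_) (^-distribˡ-+-* p m m)) (rearrange P N))
      where
      rearrange : ∀ a b → a * (b * b) ≡ b * a * b
      rearrange = solve-∀

    x-vertex : NVert p k x
    x-vertex = x<q , ∣n⇒∣m*n x̃ (p∣p^ (≤-trans 1≤m (m≤m+n m m)))

    RootLift : ℕ → ℕ → Set
    RootLift z h = h < P × h % p ≡ z × (h * h ≡ x̃ [mod P ])

    root-lift-exists : ∀ {z} → z ∈ Z → ∃ (RootLift z)
    root-lift-exists {z} z∈Z with ∈-sqrts⁻ z∈Z
    ... | 1≤z , z<p , z²≡x̃ with hensel p∤z (%⇒mod z²≡x̃) (pred (k ∸ ℓ))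
      where
      p∤z : ¬ p ∣ z
      p∤z p∣z = <⇒≱ z<p (∣⇒≤ {{>-nonZero 1≤z}} p∣z)
    ...   | w , w≡z , w²≡x̃ =
      w % P , m%n<n w P , mod⇒%≡ z<p (mod-trans (mod-weaken p∣P (mod-sym (mod-% w P))) w≡z) ,
      mod-trans (mod-square (mod-sym (mod-% w P)))
                (subst (λ e → w * w ≡ x̃ [mod p ^ e ]) (suc-pred (k ∸ ℓ) {{>-nonZero (m<n⇒0<n∸m ℓ<k)}}) w²≡x̃)

    -- Set to 0 off Z, so that the lifts form a plain function ℕ → ℕ.
    root-lift : ℕ → ℕ
    root-lift z with z ∈? Z
    ... | yes z∈Z = proj₁ (root-lift-exists z∈Z)
    ... | no _ = 0

    root-lift-spec : ∀ {z} → z ∈ Z → RootLift z (root-lift z)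
    root-lift-spec {z} z∈Z with z ∈? Z
    ... | yes z∈Z′ = proj₂ (root-lift-exists z∈Z′)
    ... | no z∉Z = ⊥-elim (z∉Z z∈Z)

    lifted : ℕ → ℕ → ℕ
    lifted z j = root-lift z + j * P

    preimage : ℕ → ℕ → ℕ
    preimage z j = lifted z j * N

    lifted%p : ∀ {z} → z ∈ Z → ∀ j → lifted z j % p ≡ z
    lifted%p z∈Z j = trans (%-remove-+ʳ (root-lift _) (∣n⇒∣m*n j p∣P)) (proj₁ (proj₂ (root-lift-spec z∈Z)))

    p∤lifted : ∀ {z} → z ∈ Z → ∀ j → ¬ p ∣ lifted z j
    p∤lifted {z} z∈Z j p∣ = <⇒≢ (proj₁ (∈-sqrts⁻ z∈Z)) (trans (sym (n∣m⇒m%n≡0 _ p p∣)) (lifted%p z∈Z j))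

    lifted-square : ∀ {z} → z ∈ Z → ∀ j → lifted z j * lifted z j ≡ x̃ [mod P ]
    lifted-square z∈Z j = mod-trans (mod-square (mod-+-multiple P (root-lift _) j)) (proj₂ (proj₂ (root-lift-spec z∈Z)))

    preimage<q : ∀ {z j} → z ∈ Z → j < N → preimage z j < q
    preimage<q {z} {j} z∈Z j<N = subst (preimage z j <_) (sym q≡N*P*N) (*-monoˡ-< N lifted<N*P)
      where
      lifted<N*P : lifted z j < N * P
      lifted<N*P = ≤-trans (+-monoˡ-≤ (j * P) (proj₁ (root-lift-spec z∈Z))) (*-monoˡ-≤ P j<N)

    preimage-edge : ∀ {z j} → z ∈ Z → j < N → NEdge p k (preimage z j) x
    preimage-edge {z} {j} z∈Z j<N =
      (preimage<q z∈Z j<N , ∣n⇒∣m*n (lifted z j) (p∣p^ 1≤m)) , x-vertex , preimage<q z∈Z j<N ,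
      sym (trans (mod≡% _ q) (mod⇒%≡ x<q (subst₂ (λ a Q → a ≡ x [mod Q ]) (sym square) (sym (^-split (<⇒≤ ℓ<k)))
                                                 (mod-*-scale (p ^ ℓ) (lifted-square z∈Z j)))))
      where
      square : preimage z j * preimage z j ≡ (lifted z j * lifted z j) * p ^ ℓ
      square = trans (square-* (lifted z j) N) (cong (lifted z j * lifted z j *_) (sym (^-distribˡ-+-* p m m)))

    preimage-injective : ∀ z z′ j j′ → z ∈ Z → z′ ∈ Z → j < N → j′ < N →
                         preimage z j ≡ preimage z′ j′ → z ≡ z′ × j ≡ j′
    preimage-injective z z′ j j′ z∈Z z′∈Z _ _ eq = z≡z′ , j≡j′
      where
      lifted≡ : lifted z j ≡ lifted z′ j′
      lifted≡ = *-cancelʳ-≡ _ _ N eq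
      lifted%P : ∀ {z} → z ∈ Z → ∀ j → lifted z j % P ≡ root-lift z
      lifted%P z∈Z j = trans ([m+kn]%n≡m%n (root-lift _) j P) (m<n⇒m%n≡m (proj₁ (root-lift-spec z∈Z)))
      root≡ : root-lift z ≡ root-lift z′
      root≡ = trans (sym (lifted%P z∈Z j)) (trans (cong (_% P) lifted≡) (lifted%P z′∈Z j′))
      z≡z′ : z ≡ z′
      z≡z′ = trans (sym (proj₁ (proj₂ (root-lift-spec z∈Z))))
                   (trans (cong (_% p) root≡) (proj₁ (proj₂ (root-lift-spec z′∈Z))))
      j≡j′ : j ≡ j′
      j≡j′ = *-cancelʳ-≡ j j′ P (+-cancelˡ-≡ (root-lift z′) (j * P) (j′ * P) (trans (cong (_+ j * P) (sym root≡)) lifted≡))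

    preimage-surjective : ∀ y → NEdge p k y x → ∃₂ λ z j → z ∈ Z × j < N × y ≡ preimage z j
    preimage-surjective y e with square-preimage p∤x̃ ℓ<k (sym (edge-target e))
    ... | w , m′ , ℓ≡2m′ , y≡wN , w²≡x̃ with +-double-injective m m′ ℓ≡2m′
    ... | refl = z , j , z∈Z , j<N , y≡preimage
      where
      z : ℕ
      z = w % p
      A : ℕ
      A = w % P
      j : ℕ
      j = w / P
      p∤w : ¬ p ∣ w
      p∤w p∣w = p∤x̃ (mod-∣ p∣P w²≡x̃ (∣m⇒∣m*n w p∣w))
      1≤z : 1 ≤ z
      1≤z = n≢0⇒n>0 (λ z≡0 → p∤w (m%n≡0⇒n∣m w p z≡0))
      z∈Z : z ∈ Z
      z∈Z = ∈-sqrts⁺ 1≤z (m%n<n w p) (trans (sym (%-distribˡ-* w w p)) (mod⇒% (mod-weaken p∣P w²≡x̃)))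
      A%p≡z : A % p ≡ z
      A%p≡z = m∣n⇒o%n%m≡o%m p P w p∣P
      A≡root : A ≡ root-lift z
      A≡root = trans (sym (m%n%n≡m%n w P)) (mod⇒%≡ (proj₁ (root-lift-spec z∈Z))
        (square-root-lift-unique {n = k ∸ ℓ} (λ p∣A → <⇒≢ 1≤z (trans (sym (n∣m⇒m%n≡0 A p p∣A)) A%p≡z))
                                 (%⇒mod (trans A%p≡z (sym (proj₁ (proj₂ (root-lift-spec z∈Z))))))
                                 (mod-trans (mod-square (mod-sym (mod-% w P))) w²≡x̃)
                                 (proj₂ (proj₂ (root-lift-spec z∈Z)))))
      j<N : j < N
      j<N = m<n*o⇒m/o<n (*-cancelʳ-< N w (N * P) (subst₂ _<_ y≡wN q≡N*P*N (proj₁ (proj₁ e))))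
      y≡preimage : y ≡ preimage z j
      y≡preimage = trans y≡wN (cong (_* N) (trans (m≡m%n+[m/n]*n w P) (cong (_+ j * P) A≡root)))

    in-tree : ∀ f → (∀ {x̃′} → ¬ p ∣ x̃′ → x̃′ * N < q → InTreeIso p k (x̃′ * N) (𝒯-fuel p f (x̃′ mod p) m)) →
              InTreeIso p k x (node (concatMap (λ z → replicate N (𝒯-fuel p f z m)) Z))
    in-tree f in-tree-below = in-tree-node x x-vertex (acyclic x x-vertex (m<n⇒n≢0 (unit*p^≥1 ℓ p∤x̃))) _ (label Z)
      (label-injective Z preimage-injective Z (λ z∈Z → z∈Z) (sqrts-unique (x̃ mod p)))
      label-edge label-covers label-iso
      where
      open InTreeGluing p k
      open ConcatReplicate N (λ z → 𝒯-fuel p f z m) preimage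
      label-edge : ∀ i → NEdge p k (label Z i) x
      label-edge i with label-spec Z i
      ... | z , j , z∈Z , j<N , _ , label≡ = subst (λ v → NEdge p k v x) (sym label≡) (preimage-edge z∈Z j<N)
      label-covers : ∀ y → NVert p k y → NEdge p k y x → ∃ λ i → label Z i ≡ y
      label-covers y _ e with preimage-surjective y e
      ... | z , j , z∈Z , j<N , y≡ with label-surjective Z z j z∈Z j<N
      ...   | i , label≡ = i , trans label≡ (sym y≡)
      label-iso : ∀ i → InTreeIso p k (label Z i) (lookup (concatMap copies Z) i)
      label-iso i with label-spec Z i
      ... | z , j , z∈Z , j<N , lookup≡ , label≡ = subst₂ (InTreeIso p k) (sym label≡) (sym lookup≡)
            (subst (λ t → InTreeIso p k (preimage z j) (𝒯-fuel p f t m)) (trans (mod≡% _ p) (lifted%p z∈Z j))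
                   (in-tree-below (p∤lifted z∈Z j) (preimage<q z∈Z j<N)))

  in-tree-leaf : ∀ m x̃ → ¬ p ∣ x̃ → x̃ * p ^ suc (m + m) < q → InTreeIso p k (x̃ * p ^ suc (m + m)) (node [])
  in-tree-leaf m x̃ p∤x̃ x<q = in-tree-node x xv (acyclic x xv (m<n⇒n≢0 (unit*p^≥1 ℓ p∤x̃))) [] (λ ()) (λ ()) (λ ())
    (λ y yv e → ⊥-elim (no-preimage y e)) (λ ())
    where
    open InTreeGluing p k
    ℓ : ℕ
    ℓ = suc (m + m)
    x : ℕ
    x = x̃ * p ^ ℓ
    xv : NVert p k x
    xv = x<q , ∣n⇒∣m*n x̃ (p∣p^ {ℓ} (s≤s z≤n))
    no-preimage : ∀ y → NEdge p k y x → ⊥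
    no-preimage y e with square-preimage {y = y} p∤x̃ (exponent<k {x̃ = x̃} (unit*p^≥1 ℓ p∤x̃) x<q refl) (sym (edge-target e))
    ... | _ , m′ , ℓ≡2m′ , _ = ⊥-elim (m+m≢1+n+n m′ m (sym ℓ≡2m′))

  in-tree-fuel : ∀ f ℓ x̃ → 1 ≤ ℓ → ℓ ≤ f → ¬ p ∣ x̃ → x̃ * p ^ ℓ < q →
                 InTreeIso p k (x̃ * p ^ ℓ) (𝒯-fuel p f (x̃ mod p) ℓ)
  in-tree-fuel zero ℓ x̃ 1≤ℓ ℓ≤0 = ⊥-elim (<⇒≱ 1≤ℓ ℓ≤0)
  in-tree-fuel (suc f) ℓ x̃ 1≤ℓ ℓ≤f p∤x̃ x<q with even-or-odd ℓ
  ... | inj₂ (m , refl) = subst (InTreeIso p k _) (sym (𝒯-fuel-odd p f (x̃ mod p) m)) (in-tree-leaf m x̃ p∤x̃ x<q)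
  ... | inj₁ (m , refl) = subst (InTreeIso p k _) (sym (𝒯-fuel-even p f (x̃ mod p) m))
          (Children.in-tree m x̃ 1≤m p∤x̃ x<q f (λ p∤x̃′ x′<q → in-tree-fuel f m _ 1≤m m≤f p∤x̃′ x′<q))
    where
    1≤m : 1 ≤ m
    1≤m = n≢0⇒n>0 (λ m≡0 → <⇒≱ 1≤ℓ (subst (λ n → n + n ≤ 0) (sym m≡0) z≤n))
    m≤f : m ≤ f
    m≤f = s≤s⁻¹ (≤-trans (+-monoˡ-≤ m 1≤m) ℓ≤f)

  in-tree : ∀ x x̃ ℓ → 1 ≤ x → x < q → p ∣ x → Coprime x̃ p → x ≡ x̃ * p ^ ℓ →
            InTreeIso p k x (𝒯 p (x̃ mod p) ℓ)
  in-tree _ x̃ ℓ _ x<q p∣x x̃⊥p refl = in-tree-fuel ℓ ℓ x̃ 1≤ℓ ≤-refl p∤x̃ x<q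
    where
    p∤x̃ : ¬ p ∣ x̃
    p∤x̃ = coprime⇒∤ x̃⊥p
    1≤ℓ : 1 ≤ ℓ
    1≤ℓ = n≢0⇒n>0 (λ ℓ≡0 → p∤x̃ (subst (p ∣_) (trans (cong (λ e → x̃ * p ^ e) ℓ≡0) (*-identityʳ x̃)) p∣x))

mainTheorem3 : (p k : ℕ) → Prime p → ¬ (2 ∣ p) → 1 ≤ k →
    -- N(p^k) has p^{k-1} vertices
    (length (filter (p ∣?_) (upTo (p ^ k))) ≡ p ^ (k ∸ 1))
    -- N(p^k) is closed under squaring, so every vertex has out-degree 1 in N(p^k)
    × (∀ x → NVert p k x → NVert p k ((x * x) mod (p ^ k)))
    -- 0 is a vertex with a loop
    × NVert p k 0 × NEdge p k 0 0
    -- every vertex has a directed path to 0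
    × (∀ x → NVert p k x → NPath p k x 0)
    -- no cycles other than the loop at 0
    × (∀ x → NVert p k x → x ≢ 0 → ¬ TransClosure (NEdge p k) x x)
    -- the vertices ≠ 0 with an edge into 0
    × (∀ x → (NVert p k x × x ≢ 0 × NEdge p k x 0) →
         ∃₂ λ y ℓ → k ≤ 2 * ℓ × ℓ < k × 1 ≤ y × y ≤ p ^ (k ∸ ℓ) × Coprime y p × x ≡ y * p ^ ℓ)
    × (∀ y ℓ → k ≤ 2 * ℓ → ℓ < k → 1 ≤ y → y ≤ p ^ (k ∸ ℓ) → Coprime y p →
         NVert p k (y * p ^ ℓ) × y * p ^ ℓ ≢ 0 × NEdge p k (y * p ^ ℓ) 0
         × InTreeIso p k (y * p ^ ℓ) (𝒯 p (y mod p) ℓ))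
    -- general in-trees
    × (∀ x x̃ ℓ → 1 ≤ x → x < p ^ k → p ∣ x → Coprime x̃ p → x ≡ x̃ * p ^ ℓ →
         InTreeIso p k x (𝒯 p (x̃ mod p) ℓ))
mainTheorem3 p k pr odd 1≤k =
  multiplesBelow-^ k 1≤k , square-closed , 0-vertex , 0-loop , path-to-0 , acyclic ,
  edge-into-0⇒ , edge-into-0-with-tree , in-tree
  where
  open Multiples p {{prime⇒nonZero pr}}
  open NilpotentPart pr k 1≤k
  open InTrees pr odd k 1≤k
  edge-into-0-with-tree : ∀ y ℓ → k ≤ 2 * ℓ → ℓ < k → 1 ≤ y → y ≤ p ^ (k ∸ ℓ) → Coprime y p →
    NVert p k (y * p ^ ℓ) × y * p ^ ℓ ≢ 0 × NEdge p k (y * p ^ ℓ) 0 × InTreeIso p k (y * p ^ ℓ) (𝒯 p (y mod p) ℓ)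
  edge-into-0-with-tree y ℓ k≤2ℓ ℓ<k 1≤y y≤p^[k∸ℓ] y⊥p =
    let xv , x≢0 , e = edge-into-0⇐ y ℓ k≤2ℓ ℓ<k 1≤y y≤p^[k∸ℓ] y⊥p
    in xv , x≢0 , e , in-tree _ y ℓ (n≢0⇒n>0 x≢0) (proj₁ xv) (proj₂ xv) y⊥p refl
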